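{- Consider an instance of the h-FSTSP with Hamiltonian cycle $h=(v_0,v_1,\dots,v_{n+1})$, and let $0\le i<j<k\le n+1$. If the drone is fast in operation $o_{i,j,k}$, then there exists an optimal solution of the h-FSTSP that contains no operation $o_{i',j,k'}$ with $0\le i'\le i$, $k\le k'\le n+1$ and $(i',k')\ne(i,k)$; i.e., all such operations other than $o_{i,j,k}$ can be ignored by an algorithm for the h-FSTSP without losing optimality.
   Context: Instance: $n\ge1$, nodes $N=\{0,\dots,n+1\}$ where $0$ and $n+1$ both denote the depot, customers $C=\{1,\dots,n\}$, truck times $t_R(u,v)\ge0$ and drone times $t_D(u,v)\ge0$, and a Hamiltonian cycle $h=(v_0,\dots,v_{n+1})$ with $v_0=0$, $v_{n+1}=n+1$, $(v_1,\dots,v_n)$ a permutation of $C$. For $0\le a<b\le n+1$, the truck-only operation on $[a,b]$ has truck path $(v_a,v_{a+1},\dots,v_b)$, no drone, and time $\sum_{\ell=a}^{b-1}t_R(v_\ell,v_{\ell+1})$. For $0\le a<c<b\le n+1$, the drone operation $o_{a,c,b}$ has truck path $r=(v_a,\dots,v_{c-1},v_{c+1},\dots,v_b)$ with time $t(r)=\sum_{\ell=a}^{c-2}t_R(v_\ell,v_{\ell+1})+t_R(v_{c-1},v_{c+1})+\sum_{\ell=c+1}^{b-1}t_R(v_\ell,v_{\ell+1})$, drone path $d=(v_a,v_c,v_b)$ with time $t(d)=t_D(v_a,v_c)+t_D(v_c,v_b)$, and time $t(o_{a,c,b})=\max\{t(r),t(d)\}$. The drone is fast in $o_{a,c,b}$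 if $t(d)\le t(r)$. A solution of the h-FSTSP (an FSTSP solution respecting $h$: truck visits its nodes in the order of $h$, and each drone node lies in $h$ strictly between its launch and rendezvous nodes, each customer served exactly once by truck or drone, both vehicles leaving and returning to the depot) is a sequence of operations on consecutive index intervals $[a_0,a_1],[a_1,a_2],\dots,[a_{s-1},a_s]$ with $0=a_0<a_1<\dots<a_s=n+1$, each operation being either the truck-only operation or a drone operation $o_{a_{\ell-1},c,a_\ell}$ on its interval; its cost is the sum of the times of its operations. The h-FSTSP asks for a solution of minimum cost.
   Formalization: The truck times and drone times of the instance take values in the nonnegative rationals. -}

module Defs where

open import Data.Nat as ℕ using (ℕ; zero; suc; _∸_; _<?_)
open import Data.Fin using (Fin; fromℕ<; fromℕ)
import Data.Fin as Fin
open import Data.Rational using (ℚ; 0ℚ; _+_; _⊔_; _≤_)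
open import Data.List using (List; []; _∷_)
open import Data.Product using (_×_; Σ)
open import Relation.Binary.PropositionalEquality using (_≡_)
open import Relation.Nullary using (yes; no)
open import Function.Definitions using (Injective)

-- Nodes 0,…,n+1 (0 and n+1 both the depot) are Fin (2 + n).
Node : ℕ → Set
Node n = Fin (suc (suc n))

record Instance (n : ℕ) : Set where
  field
    n≥1     : 1 ℕ.≤ n
    tR      : Node n → Node n → ℚ
    tD      : Node n → Node n → ℚ
    tR≥0    : ∀ u w → 0ℚ ≤ tR u w
    tD≥0    : ∀ u w → 0ℚ ≤ tD u w
    -- Hamiltonian cycle h = (v 0, …, v (n+1)): v 0 = 0, v (n+1) = n+1,
    -- (v 1, …, v n) a permutation of the customers (⇔ v a bijection of
    -- Fin (2+n) fixing both ends; injective suffices on a finite set).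
    v       : Node n → Node n
    v-inj   : Injective _≡_ _≡_ v
    v-first : v Fin.zero ≡ Fin.zero
    v-last  : v (fromℕ (suc n)) ≡ fromℕ (suc n)

module _ {n : ℕ} (I : Instance n) where
  open Instance I

  -- v_ℓ for an index ℓ : ℕ (only ever used for ℓ ≤ n+1; default otherwise)
  vAt : ℕ → Node n
  vAt ℓ with ℓ <? suc (suc n)
  ... | yes p = v (fromℕ< p)
  ... | no _  = Fin.zero

  TR TD : ℕ → ℕ → ℚ
  TR a b = tR (vAt a) (vAt b)
  TD a b = tD (vAt a) (vAt b)

  segment : ℕ → ℕ → ℚ
  segment a zero    = 0ℚ
  segment a (suc m) = TR a (suc a) + segment (suc a) m

  pathTime : ℕ → ℕ → ℚ
  pathTime a b = segment a (b ∸ a)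

  droneTruckTime : ℕ → ℕ → ℕ → ℚ
  droneTruckTime a c b =
    pathTime a (c ∸ 1) + TR (c ∸ 1) (suc c) + pathTime (suc c) b

  droneFlightTime : ℕ → ℕ → ℕ → ℚ
  droneFlightTime a c b = TD a c + TD c b

  DroneFast : ℕ → ℕ → ℕ → Set
  DroneFast a c b = droneFlightTime a c b ≤ droneTruckTime a c b

data Op : Set where
  truckOp : ℕ → ℕ → Op
  droneOp : ℕ → ℕ → ℕ → Op

start end : Op → ℕ
start (truckOp a b)   = a
start (droneOp a c b) = a
end (truckOp a b)     = b
end (droneOp a c b)   = b

WellFormedOp : Op → Set
WellFormedOp (truckOp a b)   = a ℕ.< b
WellFormedOp (droneOp a c b) = a ℕ.< c × c ℕ.< b

ChainFrom : ℕ → ℕ → List Op → Set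
ChainFrom n a []       = a ≡ suc n
ChainFrom n a (o ∷ os) = start o ≡ a × WellFormedOp o × ChainFrom n (end o) os

IsSolution : ℕ → List Op → Set
IsSolution n S = ChainFrom n 0 S

module _ {n : ℕ} (I : Instance n) where

  opTime : Op → ℚ
  opTime (truckOp a b)   = pathTime I a b
  opTime (droneOp a c b) = droneTruckTime I a c b ⊔ droneFlightTime I a c b

  cost : List Op → ℚ
  cost []       = 0ℚ
  cost (o ∷ os) = opTime o + cost os

  IsOptimal : List Op → Set
  IsOptimal S = IsSolution n S × (∀ S′ → IsSolution n S′ → cost S ≤ cost S′)

-- Suppose the drone is fast in o_{i,j,k} and a solution uses some o_{a,j,b}
-- with a ≤ i and k ≤ b. Reroute that stretch: truck alone from v_a to v_i,
-- then o_{i,j,k}, then truck alone from v_k to v_b. As the drone is fast,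
-- o_{i,j,k} costs exactly its truck time, so the reroute costs the truck time
-- of o_{a,j,b}, which is at most t(o_{a,j,b}). Rerouting every such operation
-- of an optimal solution (one exists: there are finitely many solutions)
-- therefore yields an optimal solution whose only operation of this shape is
-- o_{i,j,k} itself.
module Submission where

open import Defs
open import Data.Nat using (ℕ; zero; suc; _+_; _∸_; _<_; _≤_; _<?_; _≤?_; _≟_; z≤n; s≤s)
import Data.Nat.Properties as ℕₚ
open import Data.Rational as ℚ using (ℚ; 0ℚ)
import Data.Rational.Properties as ℚₚ
open import Data.List using (List; []; _∷_; _++_; map; concatMap; upTo; cartesianProductWith; filter)
open import Data.List.Membership.Propositional using (_∈_; _∉_; lose)
open import Data.List.Membership.Propositional.Properties
  using (∈-map⁺; ∈-++⁺ˡ; ∈-++⁺ʳ; ∈-upTo⁺; ∈-cartesianProductWith⁺; ∈-concatMap⁺; ∈-filter⁺)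
open import Data.List.Relation.Unary.Any using (here; there)
open import Data.List.Relation.Unary.All as All using (All; []; _∷_)
open import Data.List.Relation.Unary.All.Properties using (++⁺; all-filter)
import Data.List.Extrema
open import Data.Product using (_×_; _,_; ∃)
open import Data.Empty using (⊥; ⊥-elim)
open import Relation.Binary.Bundles using (DecTotalOrder)
open import Relation.Binary.PropositionalEquality using (_≡_; _≢_; refl; sym; cong; cong₂; module ≡-Reasoning)
open import Relation.Nullary using (Dec; yes; no)
open import Relation.Nullary.Decidable using (_×-dec_)
open import Tactic.MonoidSolver using (solve)

Chain : ℕ → List Op → ℕ → Set
Chain a []       b = a ≡ b
Chain a (o ∷ os) b = start o ≡ a × WellFormedOp o × Chain (end o) os b

solution⇒chain : ∀ {n a} S → ChainFrom n a S → Chain a S (suc n)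
solution⇒chain []       a≡n+1          = a≡n+1
solution⇒chain (o ∷ os) (st , wf , os′) = st , wf , solution⇒chain os os′

chain⇒solution : ∀ {n a} S → Chain a S (suc n) → ChainFrom n a S
chain⇒solution []       a≡n+1          = a≡n+1
chain⇒solution (o ∷ os) (st , wf , os′) = st , wf , chain⇒solution os os′

Chain-++ : ∀ {a m b} xs {ys} → Chain a xs m → Chain m ys b → Chain a (xs ++ ys) b
Chain-++ []       refl            ys′ = ys′
Chain-++ (o ∷ xs) (st , wf , xs′) ys′ = st , wf , Chain-++ xs xs′ ys′

start<end : ∀ o → WellFormedOp o → start o < end o
start<end (truckOp a b)   a<b         = a<b
start<end (droneOp a c b) (a<c , c<b) = ℕₚ.<-trans a<c c<b

Chain-≤ : ∀ {a b} S → Chain a S b → a ≤ b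
Chain-≤ []       refl               = ℕₚ.≤-refl
Chain-≤ (o ∷ os) (refl , wf , os′) = ℕₚ.<⇒≤ (ℕₚ.<-≤-trans (start<end o wf) (Chain-≤ os os′))

wellFormed? : ∀ o → Dec (WellFormedOp o)
wellFormed? (truckOp a b)   = a <? b
wellFormed? (droneOp a c b) = (a <? c) ×-dec (c <? b)

chain? : ∀ a S b → Dec (Chain a S b)
chain? a []       b = a ≟ b
chain? a (o ∷ os) b = (start o ≟ a) ×-dec (wellFormed? o ×-dec chain? (end o) os b)

opsFrom : ℕ → ℕ → List Op
opsFrom M a = map (truckOp a) (upTo M) ++ cartesianProductWith (droneOp a) (upTo M) (upTo M)

∈-opsFrom : ∀ {M a} o → start o ≡ a → WellFormedOp o → end o < M → o ∈ opsFrom M a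
∈-opsFrom (truckOp a b)   refl _         b<M = ∈-++⁺ˡ (∈-map⁺ (truckOp a) (∈-upTo⁺ b<M))
∈-opsFrom {M} (droneOp a c b) refl (_ , c<b) b<M = ∈-++⁺ʳ (map (truckOp a) (upTo M))
  (∈-cartesianProductWith⁺ (droneOp a) (∈-upTo⁺ (ℕₚ.<-trans c<b b<M)) (∈-upTo⁺ b<M))

chainsFrom : ℕ → ℕ → ℕ → List (List Op)
chainsFrom M zero    a = [] ∷ []
chainsFrom M (suc f) a = [] ∷ concatMap (λ o → map (o ∷_) (chainsFrom M f (end o))) (opsFrom M a)

∈-chainsFrom : ∀ {M} f {a b} S → Chain a S b → b < M → b ≤ f + a → S ∈ chainsFrom M f a
∈-chainsFrom zero    []       _ _ _ = here refl
∈-chainsFrom (suc f) []       _ _ _ = here refl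
∈-chainsFrom zero    (o ∷ os) (refl , wf , os′) _ b≤a =
  ⊥-elim (ℕₚ.<⇒≱ (ℕₚ.<-≤-trans (start<end o wf) (Chain-≤ os os′)) b≤a)
∈-chainsFrom {M} (suc f) {a} {b} (o ∷ os) (refl , wf , os′) b<M b≤f+a =
  there (∈-concatMap⁺ (λ o → map (o ∷_) (chainsFrom M f (end o)))
    (lose (∈-opsFrom o refl wf (ℕₚ.≤-<-trans (Chain-≤ os os′) b<M))
          (∈-map⁺ (o ∷_) (∈-chainsFrom f os os′ b<M b≤f+end))))
  where
  b≤f+end : b ≤ f + end o
  b≤f+end = ℕₚ.≤-trans b≤f+a (ℕₚ.≤-trans (ℕₚ.≤-reflexive (sym (ℕₚ.+-suc f a)))
                                         (ℕₚ.+-monoʳ-≤ f (start<end o wf)))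

open Data.List.Extrema (DecTotalOrder.totalOrder ℚₚ.≤-decTotalOrder)
  using (argmin; argmin-all; f[argmin]≤f[xs])

solutions : ∀ n → List (List Op)
solutions n = filter (λ S → chain? 0 S (suc n)) (chainsFrom (suc (suc n)) (suc n) 0)

solutions-chain : ∀ n → All (λ S → Chain 0 S (suc n)) (solutions n)
solutions-chain n = all-filter (λ S → chain? 0 S (suc n)) (chainsFrom (suc (suc n)) (suc n) 0)

∈-solutions : ∀ {n} S → IsSolution n S → S ∈ solutions n
∈-solutions {n} S sol = ∈-filter⁺ (λ S → chain? 0 S (suc n))
  (∈-chainsFrom (suc n) S chain ℕₚ.≤-refl (ℕₚ.m≤m+n (suc n) 0)) chain
  where
  chain : Chain 0 S (suc n)
  chain = solution⇒chain S sol

optimal-exists : ∀ {n} (I : Instance n) → ∃ (IsOptimal I)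
optimal-exists {n} I =
  S* ,
  chain⇒solution S* (argmin-all (cost I) (refl , s≤s z≤n , refl) (solutions-chain n)) ,
  λ S sol → All.lookup (f[argmin]≤f[xs] truckOnly (solutions n)) (∈-solutions S sol)
  where
  truckOnly : List Op
  truckOnly = truckOp 0 (suc n) ∷ []

  S* : List Op
  S* = argmin (cost I) truckOnly (solutions n)

module _ {n : ℕ} (I : Instance n) where
  open ≡-Reasoning

  segment-+ : ∀ a m p → segment I a (m + p) ≡ segment I a m ℚ.+ segment I (a + m) p
  segment-+ a zero    p rewrite ℕₚ.+-identityʳ a = sym (ℚₚ.+-identityˡ _)
  segment-+ a (suc m) p rewrite segment-+ (suc a) m p | ℕₚ.+-suc a m =
    sym (ℚₚ.+-assoc (TR I a (suc a)) (segment I (suc a) m) (segment I (suc (a + m)) p))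

  pathTime-offset : ∀ a m → pathTime I a (a + m) ≡ segment I a m
  pathTime-offset a m = cong (segment I a) (ℕₚ.m+n∸m≡n a m)

  pathTime-refl : ∀ a → pathTime I a a ≡ 0ℚ
  pathTime-refl a = cong (segment I a) (ℕₚ.n∸n≡0 a)

  pathTime-split : ∀ {a b c} → a ≤ b → b ≤ c → pathTime I a c ≡ pathTime I a b ℚ.+ pathTime I b c
  pathTime-split {a} a≤b b≤c with record { quotient = m ; equality = refl } ← ℕₚ.≤⇒≤″ a≤b
                             | record { quotient = p ; equality = refl } ← ℕₚ.≤⇒≤″ b≤c = begin
    pathTime I a (a + m + p)                 ≡⟨ cong (pathTime I a) (ℕₚ.+-assoc a m p) ⟩
    pathTime I a (a + (m + p))               ≡⟨ pathTime-offset a (m + p) ⟩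
    segment I a (m + p)                      ≡⟨ segment-+ a m p ⟩
    segment I a m ℚ.+ segment I (a + m) p
      ≡⟨ sym (cong₂ ℚ._+_ (pathTime-offset a m) (pathTime-offset (a + m) p)) ⟩
    pathTime I a (a + m) ℚ.+ pathTime I (a + m) (a + m + p) ∎

  droneTruckTime-widen : ∀ {a i j k b} → a ≤ i → i < j → j < k → k ≤ b →
    droneTruckTime I a j b ≡ pathTime I a i ℚ.+ (droneTruckTime I i j k ℚ.+ pathTime I k b)
  droneTruckTime-widen {a} {i} {j} {k} {b} a≤i i<j j<k k≤b = begin
    pathTime I a (j ∸ 1) ℚ.+ X ℚ.+ pathTime I (suc j) b
      ≡⟨ cong₂ (λ p q → p ℚ.+ X ℚ.+ q)
               (pathTime-split a≤i (ℕₚ.∸-monoˡ-≤ 1 i<j)) (pathTime-split j<k k≤b) ⟩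
    (A ℚ.+ B) ℚ.+ X ℚ.+ (C ℚ.+ D)
      ≡⟨ solve ℚₚ.+-0-monoid ⟩
    A ℚ.+ (B ℚ.+ X ℚ.+ C ℚ.+ D) ∎
    where
    A B X C D : ℚ
    A = pathTime I a i
    B = pathTime I i (j ∸ 1)
    X = TR I (j ∸ 1) (suc j)
    C = pathTime I (suc j) k
    D = pathTime I k b

  cost-++ : ∀ xs ys → cost I (xs ++ ys) ≡ cost I xs ℚ.+ cost I ys
  cost-++ []       ys = sym (ℚₚ.+-identityˡ (cost I ys))
  cost-++ (o ∷ xs) ys rewrite cost-++ xs ys = sym (ℚₚ.+-assoc (opTime I o) (cost I xs) (cost I ys))

truckRun : ℕ → ℕ → List Op
truckRun a b with a <? b
... | yes _ = truckOp a b ∷ []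
... | no  _ = []

truckRun-chain : ∀ {a b} → a ≤ b → Chain a (truckRun a b) b
truckRun-chain {a} {b} a≤b with a <? b
... | yes a<b = refl , a<b , refl
... | no  a≮b = ℕₚ.≤-antisym a≤b (ℕₚ.≮⇒≥ a≮b)

truckRun-cost : ∀ {n} (I : Instance n) {a b} → a ≤ b → cost I (truckRun a b) ≡ pathTime I a b
truckRun-cost I {a} {b} a≤b with a <? b
... | yes _   = ℚₚ.+-identityʳ (pathTime I a b)
... | no  a≮b with refl ← ℕₚ.≤-antisym a≤b (ℕₚ.≮⇒≥ a≮b) = sym (pathTime-refl I a)

truckRun-truckOnly : ∀ {P : Op → Set} → (∀ {a b} → P (truckOp a b)) → ∀ a b → All P (truckRun a b)
truckRun-truckOnly P-truck a b with a <? b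
... | yes _ = P-truck ∷ []
... | no  _ = []

module Reroute {n : ℕ} (I : Instance n) {i j k : ℕ}
               (i<j : i < j) (j<k : j < k) (fast : DroneFast I i j k) where

  pivot : Op
  pivot = droneOp i j k

  Encloses : Op → Set
  Encloses (truckOp _ _)   = ⊥
  Encloses (droneOp a c b) = a ≤ i × c ≡ j × k ≤ b

  encloses? : ∀ o → Dec (Encloses o)
  encloses? (truckOp _ _)   = no λ ()
  encloses? (droneOp a c b) = (a ≤? i) ×-dec ((c ≟ j) ×-dec (k ≤? b))

  Reduced : Op → Set
  Reduced o = Encloses o → o ≡ pivot

  detour : ℕ → ℕ → List Op
  detour a b = truckRun a i ++ pivot ∷ truckRun k b

  detour-chain : ∀ {a b} → a ≤ i → k ≤ b → Chain a (detour a b) b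
  detour-chain {a} a≤i k≤b =
    Chain-++ (truckRun a i) (truckRun-chain a≤i) (refl , (i<j , j<k) , truckRun-chain k≤b)

  detour-cost : ∀ {a b} → a ≤ i → k ≤ b → cost I (detour a b) ≡ droneTruckTime I a j b
  detour-cost {a} {b} a≤i k≤b = begin
    cost I (truckRun a i ++ pivot ∷ truckRun k b)
      ≡⟨ cost-++ I (truckRun a i) (pivot ∷ truckRun k b) ⟩
    cost I (truckRun a i) ℚ.+ (opTime I pivot ℚ.+ cost I (truckRun k b))
      ≡⟨ cong₂ ℚ._+_ (truckRun-cost I a≤i)
                     (cong₂ ℚ._+_ (ℚₚ.p≥q⇒p⊔q≡p fast) (truckRun-cost I k≤b)) ⟩
    pathTime I a i ℚ.+ (droneTruckTime I i j k ℚ.+ pathTime I k b)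
      ≡⟨ sym (droneTruckTime-widen I a≤i i<j j<k k≤b) ⟩
    droneTruckTime I a j b ∎
    where open ≡-Reasoning

  detour-reduced : ∀ a b → All Reduced (detour a b)
  detour-reduced a b =
    ++⁺ (truckRun-truckOnly (λ ()) a i) ((λ _ → refl) ∷ truckRun-truckOnly (λ ()) k b)

  reroute : Op → List Op
  reroute (truckOp a b) = truckOp a b ∷ []
  reroute (droneOp a c b) with encloses? (droneOp a c b)
  ... | yes _ = detour a b
  ... | no  _ = droneOp a c b ∷ []

  reroute-chain : ∀ {a} o → start o ≡ a → WellFormedOp o → Chain a (reroute o) (end o)
  reroute-chain (truckOp a b) st wf = st , wf , refl
  reroute-chain (droneOp a c b) refl wf with encloses? (droneOp a c b)
  ... | yes (a≤i , _ , k≤b) = detour-chain a≤i k≤b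
  ... | no  _               = refl , wf , refl

  reroute-cost : ∀ o → cost I (reroute o) ℚ.≤ opTime I o
  reroute-cost (truckOp a b) = ℚₚ.≤-reflexive (ℚₚ.+-identityʳ _)
  reroute-cost (droneOp a c b) with encloses? (droneOp a c b)
  ... | yes (a≤i , refl , k≤b) = ℚₚ.≤-trans (ℚₚ.≤-reflexive (detour-cost a≤i k≤b)) (ℚₚ.p≤p⊔q _ _)
  ... | no  _                  = ℚₚ.≤-reflexive (ℚₚ.+-identityʳ _)

  reroute-reduced : ∀ o → All Reduced (reroute o)
  reroute-reduced (truckOp a b) = (λ ()) ∷ []
  reroute-reduced (droneOp a c b) with encloses? (droneOp a c b)
  ... | yes _   = detour-reduced a b
  ... | no  ¬e  = (λ e → ⊥-elim (¬e e)) ∷ []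

  rerouteAll : List Op → List Op
  rerouteAll = concatMap reroute

  rerouteAll-chain : ∀ {a b} S → Chain a S b → Chain a (rerouteAll S) b
  rerouteAll-chain []       S′               = S′
  rerouteAll-chain (o ∷ os) (st , wf , os′) =
    Chain-++ (reroute o) (reroute-chain o st wf) (rerouteAll-chain os os′)

  rerouteAll-cost : ∀ S → cost I (rerouteAll S) ℚ.≤ cost I S
  rerouteAll-cost []       = ℚₚ.≤-refl
  rerouteAll-cost (o ∷ os) = ℚₚ.≤-trans (ℚₚ.≤-reflexive (cost-++ I (reroute o) (rerouteAll os)))
                                        (ℚₚ.+-mono-≤ (reroute-cost o) (rerouteAll-cost os))

  rerouteAll-reduced : ∀ S → All Reduced (rerouteAll S)
  rerouteAll-reduced []       = []
  rerouteAll-reduced (o ∷ os) = ++⁺ (reroute-reduced o) (rerouteAll-reduced os)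

  rerouteAll-optimal : ∀ {S} → IsOptimal I S → IsOptimal I (rerouteAll S)
  rerouteAll-optimal {S} (sol , minimal) =
    chain⇒solution (rerouteAll S) (rerouteAll-chain S (solution⇒chain S sol)) ,
    λ S′ sol′ → ℚₚ.≤-trans (rerouteAll-cost S) (minimal S′ sol′)

  reduced-∉ : ∀ {S a b} → All Reduced S →
              a ≤ i → k ≤ b → (a , b) ≢ (i , k) → droneOp a j b ∉ S
  reduced-∉ reduced a≤i k≤b ab≢ik o∈S with All.lookup reduced o∈S (a≤i , refl , k≤b)
  ... | refl = ab≢ik refl

theorem1 : ∀ {n : ℕ} (I : Instance n) (i j k : ℕ) →
    i < j → j < k → k ≤ suc n →
    DroneFast I i j k →
    ∃ λ S → IsOptimal I S ×
      (∀ i′ k′ → i′ ≤ i → k ≤ k′ → k′ ≤ suc n → (i′ , k′) ≢ (i , k) →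
        droneOp i′ j k′ ∉ S)
theorem1 I i j k i<j j<k _ fast with S , optimal ← optimal-exists I =
  rerouteAll S ,
  rerouteAll-optimal optimal ,
  λ i′ k′ i′≤i k≤k′ _ → reduced-∉ (rerouteAll-reduced S) i′≤i k≤k′
  where open Reroute I i<j j<k fast
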